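{- Let $I$ be an instance of Min d-BP with items $a_1,\ldots,a_n$. Suppose that for every dimension $i\in\{1,\ldots,d\}$ the Min BP instance $I_i$ has an equivalent graph $G_i=(V,E_i)$, where $V=\{v_1,\ldots,v_n\}$ and $v_j$ corresponds to item $a_j$. Let $G=(V,E_1\cap\cdots\cap E_d)$. Then $\mathrm{OPT}(I)\ge\omega(G)$.
   Context: Min d-BP: an instance consists of $n$ items $a_1,\ldots,a_n$, a number $d$ of dimensions and $n$ bins, each bin being the $d$-dimensional unit cube. Each item $a_j$ is a $d$-dimensional axis-parallel box with positive rational side length $s_{i,j}$ in dimension $i$. The task is to find $n$ pairwise disjoint (possibly empty) subsets of the items, covering all items, such that the items of each subset can be packed into a separate unit cube, and the number of non-empty subsets is minimized. Packing is without overlap and without rotation, with faces parallel to those of the cube. $\mathrm{OPT}(I)$ is this minimum. For dimension $i$, $I_i$ is the Min BP instance with items $a_1,\ldots,a_n$ and sizes $s_{i,1},\ldots,s_{i,n}$. A Min BP instance with sizes $s_1,\ldots,s_n$ and a graph $H$ are equivalent if there is a bijection $f$ from items to vertices of $H$ such that for every item subset $A'$ the characteristic vector $(x_1,\ldots,x_n)$ of $A'$ satisfies $s_1x_1+\cdots+s_nx_n\le1$ if and only if $f(A')$ is independent in $H$. $\omega(G)$ is the size of a largest clique of $G$.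
   Formalization: The positions of the items in each packing into the unit cube have rational coordinates. -}

module Defs where

open import Data.Nat using (ℕ; zero; suc)
open import Data.Fin using (Fin; zero; suc; _≟_)
open import Data.Fin.Properties using (any?)
open import Data.Fin.Subset using (Subset; _∈_; ∣_∣)
open import Data.Bool using (Bool; true; false; if_then_else_)
open import Data.Vec using (lookup; tabulate)
open import Data.Rational using (ℚ; 0ℚ; 1ℚ; _+_; _≤_; _<_)
open import Data.Product using (Σ; ∃; _×_; _,_; proj₁; proj₂)
open import Data.Sum using (_⊎_)
open import Relation.Nullary using (¬_)
open import Relation.Nullary.Decidable using (⌊_⌋)
open import Relation.Binary.PropositionalEquality using (_≡_; refl; sym)
open import Function using (_∘_)
open import Function.Bundles using (_⇔_)

sumℚ : ∀ {n} → (Fin n → ℚ) → ℚ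
sumℚ {zero}  f = 0ℚ
sumℚ {suc n} f = f zero + sumℚ (f ∘ suc)

record Graph (n : ℕ) : Set₁ where
  field
    Edge      : Fin n → Fin n → Set
    symmetric : ∀ u v → Edge u v → Edge v u
    irreflex  : ∀ v → ¬ Edge v v
open Graph public

Independent : ∀ {n} → Graph n → Subset n → Set
Independent G A = ∀ u v → u ∈ A → v ∈ A → ¬ (u ≡ v) → ¬ Edge G u v

IsClique : ∀ {n} → Graph n → Subset n → Set
IsClique G A = ∀ u v → u ∈ A → v ∈ A → ¬ (u ≡ v) → Edge G u v

load : ∀ {n} → (Fin n → ℚ) → Subset n → ℚ
load s A = sumℚ (λ j → if lookup A j then s j else 0ℚ)

-- A Min BP instance with sizes s is equivalent to H, via the bijection
-- item a_j ↦ vertex v_j (identity on Fin n).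
Equivalent : ∀ {n} → (Fin n → ℚ) → Graph n → Set
Equivalent {n} s H = ∀ (A : Subset n) → (load s A ≤ 1ℚ) ⇔ Independent H A

record Instance (d n : ℕ) : Set where
  field
    size     : Fin d → Fin n → ℚ
    size-pos : ∀ i j → 0ℚ < size i j
open Instance public

dimInstance : ∀ {d n} → Instance d n → Fin d → (Fin n → ℚ)
dimInstance I i = size I i

-- The items j with  j ∈ A  can be packed into the unit cube [0,1]^d without
-- overlap and without rotation: item j occupies the box
-- Π_i [pos i j , pos i j + s i j), and two distinct items are separated
-- in at least one dimension.
Packable : ∀ {d n} → Instance d n → Subset n → Set
Packable {d} {n} I A =
  Σ (Fin d → Fin n → ℚ) λ pos →
    (∀ j → j ∈ A → ∀ i → (0ℚ ≤ pos i j) × (pos i j + size I i j ≤ 1ℚ))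
    × (∀ j k → j ∈ A → k ∈ A → ¬ (j ≡ k) →
         ∃ λ i → (pos i j + size I i j ≤ pos i k) ⊎ (pos i k + size I i k ≤ pos i j))

binContents : ∀ {n} → (Fin n → Fin n) → Fin n → Subset n
binContents σ b = tabulate (λ j → ⌊ σ j ≟ b ⌋)

-- A feasible solution: n pairwise disjoint subsets covering all items
-- (represented as the assignment σ : items → bins), each packable.
Feasible : ∀ {d n} → Instance d n → (Fin n → Fin n) → Set
Feasible I σ = ∀ b → Packable I (binContents σ b)

usedBins : ∀ {n} → (Fin n → Fin n) → ℕ
usedBins {n} σ = ∣ tabulate (λ b → ⌊ any? (λ j → σ j ≟ b) ⌋) ∣

-- Intersection graph G = (V, E_1 ∩ ... ∩ E_d).  (The extra u ≢ v conjunct is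
-- implied by irreflexivity of each E_i whenever d ≥ 1; it only makes the
-- record well-defined uniformly in d.)
intersectGraph : ∀ {d n} → (Fin d → Graph n) → Graph n
intersectGraph Gs = record
  { Edge      = λ u v → ¬ (u ≡ v) × (∀ i → Edge (Gs i) u v)
  ; symmetric = λ u v e → (λ eq → proj₁ e (sym eq)) , (λ i → symmetric (Gs i) u v (proj₂ e i))
  ; irreflex  = λ v e → proj₁ e refl }

module Submission where

-- Let C be a clique of G = (V, E₁ ∩ … ∩ E_d) and σ a feasible assignment
-- of items to bins.  Two distinct items u, v of C are adjacent in every
-- G_i, so {u, v} is not independent in G_i and, by the equivalence of
-- I_i with G_i, s_{i,u} + s_{i,v} > 1 in every dimension i.  On the other
-- hand, two distinct items packed into the same unit cube are separated
-- along some axis i, which forces s_{i,u} + s_{i,v} ≤ 1.  Hence σ is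
-- injective on C, and it maps C into the set of used bins, so
-- ∣C∣ ≤ number of used bins.

open import Defs
open import Data.Nat using (ℕ; _≤_; z≤n; s≤s)
open import Data.Nat.Properties using (≤-trans)
open import Data.Fin using (Fin; zero; suc; _≟_)
open import Data.Fin.Properties using (any?; suc-injective; 0≢1+n)
open import Data.Fin.Subset using (Subset; _∈_; ∣_∣; ⁅_⁆; _∪_; _-_; ⊥; inside; outside)
open import Data.Fin.Subset.Properties
  using (x∈⁅x⁆; x∈⁅y⁆⇒x≡y; x∈p∪q⁺; x∈p∪q⁻; ∪-identityˡ; ∪-identityʳ; x∈p∧x≢y⇒x∈p-y; x∈p⇒∣p-x∣<∣p∣)
open import Data.Vec using ([]; _∷_; tabulate; here; there)
open import Data.Vec.Properties using (lookup⇒[]=; lookup∘tabulate)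
open import Data.Bool using (Bool; true)
open import Data.Rational using (ℚ; 0ℚ; 1ℚ; _+_) renaming (_≤_ to _≤ℚ_)
open import Data.Rational.Properties using (+-identityˡ; +-identityʳ; +-comm; +-monoˡ-≤; module ≤-Reasoning)
open import Data.Product using (∃; _×_; _,_; proj₁; proj₂)
open import Data.Sum using (_⊎_; inj₁; inj₂)
open import Data.Empty using (⊥-elim)
open import Relation.Nullary using (¬_; Dec; yes; no)
open import Relation.Nullary.Decidable using (⌊_⌋; isYes≗does; dec-true)
open import Relation.Binary.PropositionalEquality using (_≡_; refl; sym; trans; cong; subst)
open import Function using (_∘_)
open import Function.Bundles using (Equivalence)

∈-tabulate : ∀ {n} (f : Fin n → Bool) j → f j ≡ true → j ∈ tabulate f
∈-tabulate f j fj≡true = lookup⇒[]= j (tabulate f) (trans (lookup∘tabulate f j) fj≡true)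

∈-decided : ∀ {n} {P : Fin n → Set} (P? : ∀ j → Dec (P j)) j → P j
          → j ∈ tabulate (λ k → ⌊ P? k ⌋)
∈-decided P? j pj = ∈-tabulate (λ k → ⌊ P? k ⌋) j (trans (isYes≗does (P? j)) (dec-true (P? j) pj))

∈-ownBin : ∀ {n} (σ : Fin n → Fin n) j → j ∈ binContents σ (σ j)
∈-ownBin σ j = ∈-decided (λ k → σ k ≟ σ j) j refl

usedBinSet : ∀ {n} → (Fin n → Fin n) → Subset n
usedBinSet σ = tabulate (λ b → ⌊ any? (λ j → σ j ≟ b) ⌋)

∈-usedBinSet : ∀ {n} (σ : Fin n → Fin n) j → σ j ∈ usedBinSet σ
∈-usedBinSet σ j = ∈-decided (λ b → any? (λ k → σ k ≟ b)) (σ j) (j , refl)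

load-⊥ : ∀ {n} (s : Fin n → ℚ) → load s ⊥ ≡ 0ℚ
load-⊥ {ℕ.zero}  s = refl
load-⊥ {ℕ.suc n} s = trans (+-identityˡ _) (load-⊥ (s ∘ suc))

load-⁅⁆ : ∀ {n} (s : Fin n → ℚ) u → load s ⁅ u ⁆ ≡ s u
load-⁅⁆ s zero    = trans (cong (s zero +_) (load-⊥ (s ∘ suc))) (+-identityʳ _)
load-⁅⁆ s (suc u) = trans (+-identityˡ _) (load-⁅⁆ (s ∘ suc) u)

load-pair : ∀ {n} (s : Fin n → ℚ) u v → ¬ (u ≡ v) → load s (⁅ u ⁆ ∪ ⁅ v ⁆) ≡ s u + s v
load-pair s zero    zero    u≢v = ⊥-elim (u≢v refl)
load-pair s zero    (suc v) u≢v =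
  cong (s zero +_) (trans (cong (load (s ∘ suc)) (∪-identityˡ ⁅ v ⁆)) (load-⁅⁆ (s ∘ suc) v))
load-pair s (suc u) zero    u≢v =
  trans (cong (s zero +_) (trans (cong (load (s ∘ suc)) (∪-identityʳ ⁅ u ⁆)) (load-⁅⁆ (s ∘ suc) u)))
        (+-comm (s zero) (s (suc u)))
load-pair s (suc u) (suc v) u≢v =
  trans (+-identityˡ _) (load-pair (s ∘ suc) u v (u≢v ∘ cong suc))

nonAdjacent⇒independent : ∀ {n} (H : Graph n) u v → ¬ Edge H u v → Independent H (⁅ u ⁆ ∪ ⁅ v ⁆)
nonAdjacent⇒independent H u v ¬uv x y x∈ y∈ x≢y xy
  with x∈p∪q⁻ ⁅ u ⁆ ⁅ v ⁆ x∈ | x∈p∪q⁻ ⁅ u ⁆ ⁅ v ⁆ y∈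
... | inj₁ x∈u | inj₁ y∈u = x≢y (trans (x∈⁅y⁆⇒x≡y u x∈u) (sym (x∈⁅y⁆⇒x≡y u y∈u)))
... | inj₂ x∈v | inj₂ y∈v = x≢y (trans (x∈⁅y⁆⇒x≡y v x∈v) (sym (x∈⁅y⁆⇒x≡y v y∈v)))
... | inj₁ x∈u | inj₂ y∈v with x∈⁅y⁆⇒x≡y u x∈u | x∈⁅y⁆⇒x≡y v y∈v
...   | refl | refl = ¬uv xy
nonAdjacent⇒independent H u v ¬uv x y x∈ y∈ x≢y xy | inj₂ x∈v | inj₁ y∈u
  with x∈⁅y⁆⇒x≡y v x∈v | x∈⁅y⁆⇒x≡y u y∈u
...   | refl | refl = ¬uv (symmetric H x y xy)

fitting⇒nonAdjacent : ∀ {n} (s : Fin n → ℚ) (H : Graph n) → Equivalent s H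
                    → ∀ u v → ¬ (u ≡ v) → s u + s v ≤ℚ 1ℚ → ¬ Edge H u v
fitting⇒nonAdjacent s H equiv u v u≢v fits uv =
  Equivalence.to (equiv (⁅ u ⁆ ∪ ⁅ v ⁆)) pairFits u v
    (x∈p∪q⁺ (inj₁ (x∈⁅x⁆ u))) (x∈p∪q⁺ (inj₂ (x∈⁅x⁆ v))) u≢v uv
  where
  pairFits : load s (⁅ u ⁆ ∪ ⁅ v ⁆) ≤ℚ 1ℚ
  pairFits = subst (_≤ℚ 1ℚ) (sym (load-pair s u v u≢v)) fits

separated⇒lengths≤1 : ∀ (p s q t : ℚ) → 0ℚ ≤ℚ p → p + s ≤ℚ q → q + t ≤ℚ 1ℚ → s + t ≤ℚ 1ℚ
separated⇒lengths≤1 p s q t 0≤p p+s≤q q+t≤1 = begin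
  s + t       ≡⟨ cong (_+ t) (sym (+-identityˡ s)) ⟩
  0ℚ + s + t  ≤⟨ +-monoˡ-≤ t (+-monoˡ-≤ s 0≤p) ⟩
  p + s + t   ≤⟨ +-monoˡ-≤ t p+s≤q ⟩
  q + t       ≤⟨ q+t≤1 ⟩
  1ℚ          ∎
  where open ≤-Reasoning

packed⇒fitsInSomeDimension : ∀ {d n} (I : Instance d n) (A : Subset n) → Packable I A
  → ∀ u v → u ∈ A → v ∈ A → ¬ (u ≡ v) → ∃ λ i → size I i u + size I i v ≤ℚ 1ℚ
packed⇒fitsInSomeDimension I A (pos , inCube , separated) u v u∈ v∈ u≢v =
  fits (separated u v u∈ v∈ u≢v)
  where
  lower : ∀ j → j ∈ A → ∀ i → 0ℚ ≤ℚ pos i j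
  lower j j∈ i = proj₁ (inCube j j∈ i)

  upper : ∀ j → j ∈ A → ∀ i → pos i j + size I i j ≤ℚ 1ℚ
  upper j j∈ i = proj₂ (inCube j j∈ i)

  fits : (∃ λ i → (pos i u + size I i u ≤ℚ pos i v) ⊎ (pos i v + size I i v ≤ℚ pos i u))
       → ∃ λ i → size I i u + size I i v ≤ℚ 1ℚ
  fits (i , inj₁ u-before-v) = i ,
    separated⇒lengths≤1 (pos i u) (size I i u) (pos i v) (size I i v)
      (lower u u∈ i) u-before-v (upper v v∈ i)
  fits (i , inj₂ v-before-u) = i ,
    subst (_≤ℚ 1ℚ) (+-comm (size I i v) (size I i u))
      (separated⇒lengths≤1 (pos i v) (size I i v) (pos i u) (size I i u)
        (lower v v∈ i) v-before-u (upper u u∈ i))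

sameBin⇒notAdjacentEverywhere : ∀ {d n} (I : Instance d n) (Gs : Fin d → Graph n)
  → (∀ i → Equivalent (dimInstance I i) (Gs i))
  → (σ : Fin n → Fin n) → Feasible I σ
  → ∀ u v → ¬ (u ≡ v) → σ u ≡ σ v → ¬ (∀ i → Edge (Gs i) u v)
sameBin⇒notAdjacentEverywhere I Gs equiv σ feasible u v u≢v sameBin adjacent =
  noDimensionFits (packed⇒fitsInSomeDimension I bin (feasible (σ u)) u v u∈bin v∈bin u≢v)
  where
  bin : Subset _
  bin = binContents σ (σ u)

  u∈bin : u ∈ bin
  u∈bin = ∈-ownBin σ u

  v∈bin : v ∈ bin
  v∈bin = subst (λ b → v ∈ binContents σ b) (sym sameBin) (∈-ownBin σ v)

  noDimensionFits : ¬ ∃ λ i → size I i u + size I i v ≤ℚ 1ℚ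
  noDimensionFits (i , fits) = fitting⇒nonAdjacent (size I i) (Gs i) (equiv i) u v u≢v fits (adjacent i)

InjectionOn : ∀ {n m} → Subset n → Subset m → (Fin n → Fin m) → Set
InjectionOn C D f = (∀ j → j ∈ C → f j ∈ D) × (∀ j k → j ∈ C → k ∈ C → f j ≡ f k → j ≡ k)

restrictedInjective : ∀ {n m} {x} {C : Subset n} (f : Fin (ℕ.suc n) → Fin m)
  → (∀ j k → j ∈ x ∷ C → k ∈ x ∷ C → f j ≡ f k → j ≡ k)
  → ∀ j k → j ∈ C → k ∈ C → f (suc j) ≡ f (suc k) → j ≡ k
restrictedInjective f injective j k j∈ k∈ same =
  suc-injective (injective (suc j) (suc k) (there j∈) (there k∈) same)

-- A subset injecting into another is no larger.  Induction on C; an element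
-- f 0 of the image is removed from D at each step.
injection⇒∣∣≤ : ∀ {n m} (C : Subset n) (D : Subset m) (f : Fin n → Fin m)
              → InjectionOn C D f → ∣ C ∣ ≤ ∣ D ∣
injection⇒∣∣≤ [] D f _ = z≤n
injection⇒∣∣≤ (outside ∷ C) D f (into , injective) =
  injection⇒∣∣≤ C D (f ∘ suc)
    ((λ j j∈ → into (suc j) (there j∈)) , restrictedInjective f injective)
injection⇒∣∣≤ (inside ∷ C) D f (into , injective) =
  ≤-trans (s≤s (injection⇒∣∣≤ C (D - f zero) (f ∘ suc) (intoRest , restrictedInjective f injective)))
          (x∈p⇒∣p-x∣<∣p∣ (into zero here))
  where
  intoRest : ∀ j → j ∈ C → f (suc j) ∈ D - f zero
  intoRest j j∈ = x∈p∧x≢y⇒x∈p-y (into (suc j) (there j∈))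
    (λ f1+j≡f0 → 0≢1+n (sym (injective (suc j) zero (there j∈) here f1+j≡f0)))

injectiveOnClique : ∀ {d n} (I : Instance d n) (Gs : Fin d → Graph n)
  → (∀ i → Equivalent (dimInstance I i) (Gs i))
  → (σ : Fin n → Fin n) → Feasible I σ
  → (C : Subset n) → IsClique (intersectGraph Gs) C
  → ∀ j k → j ∈ C → k ∈ C → σ j ≡ σ k → j ≡ k
injectiveOnClique I Gs equiv σ feasible C clique j k j∈ k∈ sameBin with j ≟ k
... | yes j≡k = j≡k
... | no  j≢k = ⊥-elim (sameBin⇒notAdjacentEverywhere I Gs equiv σ feasible j k j≢k sameBin
                          (proj₂ (clique j k j∈ k∈ j≢k)))

-- The clique C injects into the used bins via σ.
theorem4p35 : (d n : ℕ) → 1 ≤ d → (I : Instance d n)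
    → (Gs : Fin d → Graph n)
    → (∀ i → Equivalent (dimInstance I i) (Gs i))
    → (σ : Fin n → Fin n) → Feasible I σ
    → (C : Subset n) → IsClique (intersectGraph Gs) C
    → ∣ C ∣ ≤ usedBins σ
theorem4p35 d n _ I Gs equiv σ feasible C clique =
  injection⇒∣∣≤ C (usedBinSet σ) σ
    ( (λ j _ → ∈-usedBinSet σ j)
    , injectiveOnClique I Gs equiv σ feasible C clique )
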